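{- Let $\alpha=(\alpha_1,\ldots,\alpha_n)\in\mathbb{Z}_{\ge0}^n$. For every $A=(a_{ij})$ in the Tesler poset $P(\alpha)$, the rank of $A$ (the length of any saturated chain from the least element $\hat0$ to $A$) equals $\sum_{i<j}a_{ij}$, the sum of the entries of $A$ off the main diagonal.
   Context: Let $U_n$ be the set of $n\times n$ upper-triangular matrices with nonnegative integer entries. For $A=(a_{i,j})\in U_n$ and $1\le k\le n$, the $k$-th hook sum is $h_k=(a_{k,k}+\cdots+a_{k,n})-(a_{1,k}+\cdots+a_{k-1,k})$. $\mathcal{T}(\alpha)$ is the set of $A\in U_n$ with $(h_1,\ldots,h_n)=\alpha$. The Tesler poset $P(\alpha)$ is the partial order on $\mathcal{T}(\alpha)$ that is the reflexive-transitive closure of the cover relation: $A=(a_{ij})$ covers $B=(b_{ij})$ if either there exist $i<j<k$ with $a_{ij}=b_{ij}+1$, $a_{jk}=b_{jk}+1$, $a_{ik}=b_{ik}-1$ and all other entries equal, or there exist $i<j$ with $a_{ij}=b_{ij}+1$, $a_{jj}=b_{jj}+1$, $a_{ii}=b_{ii}-1$ and all other entries equal. Its least element $\hat0$ is the diagonal matrix with diagonal $\alpha$. -}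

module Defs where

open import Data.Nat using (ℕ; zero; suc; _+_; _<_; _≤_)
open import Data.Nat.Properties using (_<?_; _≤?_)
open import Data.Integer using (ℤ; +_; _-_)
open import Data.Fin using (Fin; toℕ)
open import Data.Fin.Properties using (_≟_)
open import Data.Vec using (Vec; lookup; tabulate)
open import Data.Vec.Functional using () renaming (foldr to foldrF)
open import Data.Product using (Σ; _×_; ∃-syntax)
open import Data.Sum using (_⊎_)
open import Relation.Nullary using (¬_; does)
open import Relation.Binary.PropositionalEquality using (_≡_; _≢_)
open import Data.Bool using (if_then_else_)

Mat : ℕ → Set
Mat n = Vec (Vec ℕ n) n

ent : ∀ {n} → Mat n → Fin n → Fin n → ℕ
ent A i j = lookup (lookup A i) j

Upper : ∀ {n} → Mat n → Set
Upper {n} A = ∀ (i j : Fin n) → toℕ j < toℕ i → ent A i j ≡ 0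

sumFin : ∀ {n} → (Fin n → ℕ) → ℕ
sumFin f = foldrF _+_ 0 f

rowPart : ∀ {n} → Mat n → Fin n → ℕ
rowPart A k = sumFin (λ j → if does (toℕ k ≤? toℕ j) then ent A k j else 0)

colPart : ∀ {n} → Mat n → Fin n → ℕ
colPart A k = sumFin (λ i → if does (toℕ i <? toℕ k) then ent A i k else 0)

hook : ∀ {n} → Mat n → Fin n → ℤ
hook A k = + rowPart A k - + colPart A k

InT : ∀ {n} → (Fin n → ℕ) → Mat n → Set
InT {n} α A = Upper A × (∀ (k : Fin n) → hook A k ≡ + α k)

Move₁ : ∀ {n} → Mat n → Mat n → Set
Move₁ {n} B A = Σ (Fin n) λ i → Σ (Fin n) λ j → Σ (Fin n) λ k →
  toℕ i < toℕ j × toℕ j < toℕ k ×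
  ent A i j ≡ suc (ent B i j) × ent A j k ≡ suc (ent B j k) ×
  suc (ent A i k) ≡ ent B i k ×
  (∀ p q → ¬ (p ≡ i × q ≡ j) → ¬ (p ≡ j × q ≡ k) → ¬ (p ≡ i × q ≡ k) →
     ent A p q ≡ ent B p q)

Move₂ : ∀ {n} → Mat n → Mat n → Set
Move₂ {n} B A = Σ (Fin n) λ i → Σ (Fin n) λ j →
  toℕ i < toℕ j ×
  ent A i j ≡ suc (ent B i j) × ent A j j ≡ suc (ent B j j) ×
  suc (ent A i i) ≡ ent B i i ×
  (∀ p q → ¬ (p ≡ i × q ≡ j) → ¬ (p ≡ j × q ≡ j) → ¬ (p ≡ i × q ≡ i) →
     ent A p q ≡ ent B p q)

Step : ∀ {n} → Mat n → Mat n → Set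
Step B A = Move₁ B A ⊎ Move₂ B A

data _≼_ {n : ℕ} : Mat n → Mat n → Set where
  ≼-refl : ∀ {A} → A ≼ A
  ≼-step : ∀ {B C A} → Step B C → C ≼ A → B ≼ A

Covers : ∀ {n} → (Fin n → ℕ) → Mat n → Mat n → Set
Covers {n} α B A = InT α B × InT α A × B ≼ A × B ≢ A ×
  (∀ C → InT α C → B ≼ C → C ≼ A → C ≡ B ⊎ C ≡ A)

data SatChain {n : ℕ} (α : Fin n → ℕ) : Mat n → Mat n → Set where
  done : ∀ {A} → SatChain α A A
  _∷_  : ∀ {B C A} → Covers α B C → SatChain α C A → SatChain α B A

chainLength : ∀ {n} {α : Fin n → ℕ} {B A : Mat n} → SatChain α B A → ℕ
chainLength done = 0
chainLength (_ ∷ c) = suc (chainLength c)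

zeroHat : ∀ {n} → (Fin n → ℕ) → Mat n
zeroHat α = tabulate λ i → tabulate λ j → if does (i ≟ j) then α i else 0

offDiagSum : ∀ {n} → Mat n → ℕ
offDiagSum A = sumFin λ i → sumFin λ j → if does (toℕ i <? toℕ j) then ent A i j else 0

module Submission where

-- Both generating moves are "cell exchanges": A arises from B by taking one
-- unit from a cell (i,c) and putting one unit into each of (i,j) and (j,k),
-- with i < j ≤ k (c = k for the first move; c = i and k = j for the second).
-- Entrywise this is the identity A + E_ic = B + E_ij + E_jk of matrices, where
-- E_pq is the unit matrix at (p,q).  Row parts, column parts and ρ are additive
-- functionals of a matrix, so the identity transfers to them; evaluating them on
-- unit matrices shows that a move keeps upper-triangularity and every hook sum
-- (so it never leaves T(α), in either direction) and raises ρ by exactly one.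
--
-- Consequently ρ strictly increases along the Tesler order, every move between
-- elements of T(α) is a cover, and every cover raises ρ by exactly one, so any
-- saturated chain from 0̂ to A has length ρ(A) - ρ(0̂) = ρ(A).  A saturated chain
-- exists by induction on ρ(A): if ρ(A) = 0 then A = 0̂; otherwise some a_ij > 0
-- with i < j, the hook condition at j forces some a_jk > 0 with j ≤ k, and
-- undoing the corresponding move gives a predecessor of A in T(α).

open import Defs
open import Data.Nat using (ℕ; zero; suc; _+_; _∸_; _<_; _≤_; z≤n; s≤s)
open import Data.Nat.Properties
  using ( _≤?_; _<?_; ≤-refl; ≤-trans; ≤-reflexive; <-trans; <-irrefl; <⇒≤; <⇒≱; <-cmp
        ; ≤∧≢⇒<; ≮⇒≥; n≤0⇒n≡0; n≤1+n; m≤m+n; m≤n+m; +-comm; +-assoc; +-identityʳ; +-suc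
        ; +-cancelʳ-≡; suc-injective; +-commutativeSemigroup)
open import Algebra.Properties.CommutativeSemigroup +-commutativeSemigroup using (interchange)
open import Data.Integer as ℤ using () renaming (+_ to ⁺_)
import Data.Integer.Properties as ℤP
open import Data.Fin using (Fin; toℕ) renaming (zero to fzero; suc to fsuc)
open import Data.Fin.Properties using (_≟_; toℕ-injective) renaming (suc-injective to fsuc-injective)
open import Data.Vec using (Vec; []; _∷_; lookup; tabulate)
open import Data.Vec.Properties using (lookup∘tabulate)
open import Data.Product using (Σ; ∃; _×_; _,_; proj₁; proj₂)
open import Data.Sum using (_⊎_; inj₁; inj₂)
open import Data.Bool using (true; false; if_then_else_)
open import Data.Empty using (⊥-elim)
open import Function using (_∘_)
open import Relation.Nullary using (¬_; Dec; yes; no; does)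
open import Relation.Nullary.Decidable using (_×-dec_)
open import Relation.Unary using (Decidable)
open import Relation.Binary.PropositionalEquality
open import Relation.Binary.Definitions using (tri<; tri≈; tri>)

sum-cong : ∀ {n} {f g : Fin n → ℕ} → (∀ x → f x ≡ g x) → sumFin f ≡ sumFin g
sum-cong {zero}  f≗g = refl
sum-cong {suc n} f≗g = cong₂ _+_ (f≗g fzero) (sum-cong (f≗g ∘ fsuc))

sum-+ : ∀ {n} (f g : Fin n → ℕ) → sumFin (λ x → f x + g x) ≡ sumFin f + sumFin g
sum-+ {zero}  f g = refl
sum-+ {suc n} f g =
  trans (cong (f fzero + g fzero +_) (sum-+ (f ∘ fsuc) (g ∘ fsuc)))
        (interchange (f fzero) (g fzero) _ _)

sum-zero : ∀ {n} (f : Fin n → ℕ) → (∀ x → f x ≡ 0) → sumFin f ≡ 0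
sum-zero {zero}  f f≡0 = refl
sum-zero {suc n} f f≡0 = cong₂ _+_ (f≡0 fzero) (sum-zero (f ∘ fsuc) (f≡0 ∘ fsuc))

sum-single : ∀ {n} (f : Fin n → ℕ) k → (∀ x → x ≢ k → f x ≡ 0) → sumFin f ≡ f k
sum-single f fzero f≡0 =
  trans (cong (f fzero +_) (sum-zero (f ∘ fsuc) (λ x → f≡0 (fsuc x) (λ ()))))
        (+-identityʳ _)
sum-single f (fsuc k) f≡0 =
  cong₂ _+_ (f≡0 fzero (λ ()))
            (sum-single (f ∘ fsuc) k (λ x x≢k → f≡0 (fsuc x) (x≢k ∘ fsuc-injective)))

term≤sum : ∀ {n} (f : Fin n → ℕ) k → f k ≤ sumFin f
term≤sum f fzero    = m≤m+n _ _
term≤sum f (fsuc k) = ≤-trans (term≤sum (f ∘ fsuc) k) (m≤n+m _ _)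

sum-pos : ∀ {n} (f : Fin n → ℕ) → 0 < sumFin f → ∃ λ x → 0 < f x
sum-pos {zero}  f ()
sum-pos {suc n} f pos with 0 <? f fzero
... | yes f0>0 = fzero , f0>0
... | no f0≯0 with sum-pos (f ∘ fsuc)
                     (subst (λ t → 0 < t + sumFin (f ∘ fsuc)) (n≤0⇒n≡0 (≮⇒≥ f0≯0)) pos)
...   | x , fx>0 = fsuc x , fx>0

-- Masked sums: Σ_x [P x] f x.  Row parts, column parts and ρ are all of this form.

msum : ∀ {n} {P : Fin n → Set} → Decidable P → (Fin n → ℕ) → ℕ
msum P? f = sumFin λ x → if does (P? x) then f x else 0

if-yes : ∀ {P : Set} (d : Dec P) → P → ∀ e → (if does d then e else 0) ≡ e
if-yes (yes _) p  e = refl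
if-yes (no ¬p) p  e = ⊥-elim (¬p p)

module _ {n} {P : Fin n → Set} (P? : Decidable P) where

  msum-cong : {f g : Fin n → ℕ} → (∀ x → f x ≡ g x) → msum P? f ≡ msum P? g
  msum-cong f≗g = sum-cong (λ x → cong (λ t → if does (P? x) then t else 0) (f≗g x))

  msum-+ : (f g : Fin n → ℕ) → msum P? (λ x → f x + g x) ≡ msum P? f + msum P? g
  msum-+ f g = trans (sum-cong (λ x → split (does (P? x)) {f x} {g x}))
                     (sum-+ (λ x → if does (P? x) then f x else 0) (λ x → if does (P? x) then g x else 0))
    where
    split : ∀ b {x y} → (if b then x + y else 0) ≡ (if b then x else 0) + (if b then y else 0)
    split true  = refl
    split false = refl

  msum-vanish : (f : Fin n → ℕ) → (∀ x → P x → f x ≡ 0) → msum P? f ≡ 0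
  msum-vanish f f≡0 = sum-zero _ (λ x → masked (P? x))
    where
    masked : ∀ {x} (d : Dec (P x)) → (if does d then f x else 0) ≡ 0
    masked (yes p) = f≡0 _ p
    masked (no _)  = refl

  msum-point : ∀ (f : Fin n → ℕ) k → P k → (∀ x → x ≢ k → f x ≡ 0) → msum P? f ≡ f k
  msum-point f k pk f≡0 =
    trans (sum-single _ k (λ x x≢k → trans (cong (λ t → if does (P? x) then t else 0) (f≡0 x x≢k))
                                           (zero-either-way (does (P? x)))))
          (if-yes (P? k) pk (f k))
    where
    zero-either-way : ∀ b → (if b then 0 else 0) ≡ 0
    zero-either-way true  = refl
    zero-either-way false = refl

  msum-term : ∀ (f : Fin n → ℕ) k → P k → f k ≤ msum P? f
  msum-term f k pk = ≤-trans (≤-reflexive (sym (if-yes (P? k) pk (f k)))) (term≤sum _ k)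

  msum-pos : (f : Fin n → ℕ) → 0 < msum P? f → ∃ λ x → P x × 0 < f x
  msum-pos f pos with sum-pos _ pos
  ... | x , term>0 = x , unmask (P? x) term>0
    where
    unmask : ∀ {x} (d : Dec (P x)) → 0 < (if does d then f x else 0) → P x × 0 < f x
    unmask (yes p) fx>0 = p , fx>0
    unmask (no _)  ()

-- Matrices as functions; the row part, column part and rank (ρ) functionals.
-- Applied to 'ent A' they are definitionally rowPart A, colPart A, offDiagSum A.

Fn : ℕ → Set
Fn n = Fin n → Fin n → ℕ

_⊕_ : ∀ {n} → Fn n → Fn n → Fn n
(M ⊕ N) p q = M p q + N p q

toMat : ∀ {n} → Fn n → Mat n
toMat F = tabulate λ p → tabulate (F p)

ent-toMat : ∀ {n} (F : Fn n) p q → ent (toMat F) p q ≡ F p q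
ent-toMat F p q = trans (cong (λ row → lookup row q) (lookup∘tabulate _ p)) (lookup∘tabulate _ q)

mat-ext : ∀ {n} (A B : Mat n) → (∀ p q → ent A p q ≡ ent B p q) → A ≡ B
mat-ext A B A≗B = vec-ext A B (λ p → vec-ext _ _ (A≗B p))
  where
  vec-ext : ∀ {X : Set} {m} (u v : Vec X m) → (∀ i → lookup u i ≡ lookup v i) → u ≡ v
  vec-ext []       []       _   = refl
  vec-ext (x ∷ u) (y ∷ v) u≗v = cong₂ _∷_ (u≗v fzero) (vec-ext u v (u≗v ∘ fsuc))

onOrRightOf : ∀ {n} (k : Fin n) → Decidable (λ (j : Fin n) → toℕ k ≤ toℕ j)
onOrRightOf k j = toℕ k ≤? toℕ j

above : ∀ {n} (k : Fin n) → Decidable (λ (i : Fin n) → toℕ i < toℕ k)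
above k i = toℕ i <? toℕ k

rightOf : ∀ {n} (i : Fin n) → Decidable (λ (j : Fin n) → toℕ i < toℕ j)
rightOf i j = toℕ i <? toℕ j

rowF : ∀ {n} → Fn n → Fin n → ℕ
rowF M k = msum (onOrRightOf k) (M k)

colF : ∀ {n} → Fn n → Fin n → ℕ
colF M k = msum (above k) (λ i → M i k)

rankF : ∀ {n} → Fn n → ℕ
rankF M = sumFin λ i → msum (rightOf i) (M i)

record Additive {n} (L : Fn n → ℕ) : Set where
  field
    additive  : ∀ M N → L (M ⊕ N) ≡ L M + L N
    pointwise : ∀ {M N} → (∀ p q → M p q ≡ N p q) → L M ≡ L N

rowF-additive : ∀ {n} (m : Fin n) → Additive (λ M → rowF M m)
rowF-additive m = record
  { additive  = λ M N → msum-+ (onOrRightOf m) (M m) (N m)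
  ; pointwise = λ M≗N → msum-cong (onOrRightOf m) (M≗N m) }

colF-additive : ∀ {n} (m : Fin n) → Additive (λ M → colF M m)
colF-additive m = record
  { additive  = λ M N → msum-+ (above m) (λ i → M i m) (λ i → N i m)
  ; pointwise = λ M≗N → msum-cong (above m) (λ i → M≗N i m) }

rankF-additive : ∀ {n} → Additive (rankF {n})
rankF-additive = record
  { additive  = λ M N → trans (sum-cong (λ i → msum-+ (rightOf i) (M i) (N i)))
                               (sum-+ (λ i → msum (rightOf i) (M i)) (λ i → msum (rightOf i) (N i)))
  ; pointwise = λ M≗N → sum-cong (λ i → msum-cong (rightOf i) (M≗N i)) }

shift : ∀ {n} {L : Fn n → ℕ} → Additive L → ∀ {A B X Y Z : Fn n} t →
  (∀ p q → A p q + X p q ≡ B p q + Y p q + Z p q) →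
  L Y + L Z ≡ t + L X → L A ≡ t + L B
shift {L = L} lin {A} {B} {X} {Y} {Z} t identity balance =
  +-cancelʳ-≡ (L X) (L A) (t + L B) (begin
    L A + L X         ≡⟨ sym (additive A X) ⟩
    L (A ⊕ X)         ≡⟨ pointwise identity ⟩
    L ((B ⊕ Y) ⊕ Z)   ≡⟨ additive (B ⊕ Y) Z ⟩
    L (B ⊕ Y) + L Z   ≡⟨ cong (_+ L Z) (additive B Y) ⟩
    L B + L Y + L Z   ≡⟨ +-assoc (L B) (L Y) (L Z) ⟩
    L B + (L Y + L Z) ≡⟨ cong (L B +_) balance ⟩
    L B + (t + L X)   ≡⟨ sym (+-assoc (L B) t (L X)) ⟩
    L B + t + L X     ≡⟨ cong (_+ L X) (+-comm (L B) t) ⟩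
    t + L B + L X     ∎)
  where open ≡-Reasoning
        open Additive lin

𝟙 : ∀ {P : Set} → Dec P → ℕ
𝟙 d = if does d then 1 else 0

indicator : ∀ {P : Set} {x : ℕ} (d : Dec P) → (P → x ≡ 1) → (¬ P → x ≡ 0) → x ≡ 𝟙 d
indicator (yes p) one none = one p
indicator (no ¬p) one none = none ¬p

-- The unit matrix E_ab.  It is kept opaque: all reasoning about it goes
-- through δ-hit and δ-miss, and this keeps its arguments inferable.
opaque
  δ : ∀ {n} → Fin n → Fin n → Fn n
  δ a b p q = 𝟙 ((p ≟ a) ×-dec (q ≟ b))

  δ-hit : ∀ {n} {a b : Fin n} → δ a b a b ≡ 1
  δ-hit {a = a} {b} = if-yes ((a ≟ a) ×-dec (b ≟ b)) (refl , refl) 1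

  δ-miss : ∀ {n} {a b p q : Fin n} → ¬ (p ≡ a × q ≡ b) → δ a b p q ≡ 0
  δ-miss {a = a} {b} {p} {q} ne = indicator-no ((p ≟ a) ×-dec (q ≟ b))
    where
    indicator-no : (d : Dec (p ≡ a × q ≡ b)) → 𝟙 d ≡ 0
    indicator-no (yes eq) = ⊥-elim (ne eq)
    indicator-no (no _)   = refl

<⇒≢ᶠ : ∀ {n} {a b : Fin n} → toℕ a < toℕ b → a ≢ b
<⇒≢ᶠ a<b a≡b = <-irrefl (cong toℕ a≡b) a<b

δ-lower : ∀ {n} {a b p q : Fin n} → toℕ a ≤ toℕ b → toℕ q < toℕ p → δ a b p q ≡ 0
δ-lower a≤b q<p = δ-miss λ { (refl , refl) → <⇒≱ q<p a≤b }

rowδ : ∀ {n} {a b : Fin n} → toℕ a ≤ toℕ b → ∀ m → rowF (δ a b) m ≡ 𝟙 (m ≟ a)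
rowδ {a = a} {b} a≤b m = indicator (m ≟ a)
  (λ { refl → trans (msum-point (onOrRightOf a) (δ a b a) b a≤b (λ x x≢b → δ-miss (x≢b ∘ proj₂))) δ-hit })
  (λ m≢a → msum-vanish (onOrRightOf m) (δ a b m) (λ x _ → δ-miss (m≢a ∘ proj₁)))

colδ : ∀ {n} {a b : Fin n} → toℕ a < toℕ b → ∀ m → colF (δ a b) m ≡ 𝟙 (m ≟ b)
colδ {a = a} {b} a<b m = indicator (m ≟ b)
  (λ { refl → trans (msum-point (above b) (λ x → δ a b x b) a a<b (λ x x≢a → δ-miss (x≢a ∘ proj₁))) δ-hit })
  (λ m≢b → msum-vanish (above m) (λ x → δ a b x m) (λ x _ → δ-miss (m≢b ∘ proj₂)))

colδ-diag : ∀ {n} (a m : Fin n) → colF (δ a a) m ≡ 0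
colδ-diag a m = msum-vanish (above m) (λ x → δ a a x m)
  (λ x x<m → δ-miss (λ { (x≡a , m≡a) → <⇒≢ᶠ x<m (trans x≡a (sym m≡a)) }))

rankδ : ∀ {n} {a b : Fin n} → toℕ a < toℕ b → rankF (δ a b) ≡ 1
rankδ {a = a} {b} a<b =
  trans (sum-single (λ i → msum (rightOf i) (δ a b i)) a
           (λ i i≢a → msum-vanish (rightOf i) (δ a b i) (λ j _ → δ-miss (i≢a ∘ proj₁))))
        (trans (msum-point (rightOf a) (δ a b a) b a<b (λ j j≢b → δ-miss (j≢b ∘ proj₂))) δ-hit)

rankδ-diag : ∀ {n} (a : Fin n) → rankF (δ a a) ≡ 0
rankδ-diag a = sum-zero (λ i → msum (rightOf i) (δ a a i))
  (λ i → msum-vanish (rightOf i) (δ a a i) (λ j i<j → δ-miss (λ { (i≡a , j≡a) → <⇒≢ᶠ i<j (trans i≡a (sym j≡a)) })))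

hook-shift : ∀ t r c → ⁺ (t + r) ℤ.- ⁺ (t + c) ≡ ⁺ r ℤ.- ⁺ c
hook-shift t r c = begin
  ⁺ (t + r) ℤ.- ⁺ (t + c) ≡⟨ ℤP.[+m]-[+n]≡m⊖n (t + r) (t + c) ⟩
  (t + r) ℤ.⊖ (t + c)     ≡⟨ ℤP.+-cancelˡ-⊖ t r c ⟩
  r ℤ.⊖ c                 ≡⟨ sym (ℤP.[+m]-[+n]≡m⊖n r c) ⟩
  ⁺ r ℤ.- ⁺ c             ∎
  where open ≡-Reasoning

hook-split : ∀ r c a → ⁺ r ℤ.- ⁺ c ≡ ⁺ a → r ≡ a + c
hook-split r c a h = ℤP.+-injective (begin
  ⁺ r                          ≡⟨ sym (ℤP.+-identityʳ (⁺ r)) ⟩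
  ⁺ r ℤ.+ ℤ.0ℤ                 ≡⟨ cong (ℤ._+_ (⁺ r)) (sym (ℤP.+-inverseˡ (⁺ c))) ⟩
  ⁺ r ℤ.+ (ℤ.- ⁺ c ℤ.+ ⁺ c)    ≡⟨ sym (ℤP.+-assoc (⁺ r) (ℤ.- ⁺ c) (⁺ c)) ⟩
  (⁺ r ℤ.- ⁺ c) ℤ.+ ⁺ c        ≡⟨ cong (λ x → x ℤ.+ ⁺ c) h ⟩
  ⁺ a ℤ.+ ⁺ c                  ≡⟨ sym (ℤP.pos-+ a c) ⟩
  ⁺ (a + c)                    ∎)
  where open ≡-Reasoning

-- A arises from B by taking a unit from (i,c) and giving one
-- to each of (i,j) and (j,k), where i < j ≤ k and c is such that the column
-- parts and the rank of the lost and gained unit matrices balance.  Every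
-- exchange shifts the row and column part at j by one, the rank by one, and
-- fixes everything else.

record Exchange {n} (B A : Mat n) : Set where
  field
    i j k c        : Fin n
    i<j            : toℕ i < toℕ j
    j≤k            : toℕ j ≤ toℕ k
    i≤c            : toℕ i ≤ toℕ c
    column-balance : ∀ m → colF (δ i c) m ≡ colF (δ j k) m
    rank-balance   : rankF (δ i j) + rankF (δ j k) ≡ 1 + rankF (δ i c)
    identity       : ∀ p q → ent A p q + δ i c p q ≡ ent B p q + δ i j p q + δ j k p q

module _ {n} {B A : Mat n} (X : Exchange B A) where
  open Exchange X

  exchange-shift : ∀ {L : Fn n → ℕ} → Additive L → ∀ t →
    L (δ i j) + L (δ j k) ≡ t + L (δ i c) → L (ent A) ≡ t + L (ent B)
  exchange-shift lin t = shift lin {ent A} {ent B} {δ i c} {δ i j} {δ j k} t identity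

  exchange-row : ∀ m → rowPart A m ≡ 𝟙 (m ≟ j) + rowPart B m
  exchange-row m = exchange-shift (rowF-additive m) (𝟙 (m ≟ j)) (begin
    rowF (δ i j) m + rowF (δ j k) m ≡⟨ cong₂ _+_ (rowδ (<⇒≤ i<j) m) (rowδ j≤k m) ⟩
    𝟙 (m ≟ i) + 𝟙 (m ≟ j)           ≡⟨ +-comm (𝟙 (m ≟ i)) _ ⟩
    𝟙 (m ≟ j) + 𝟙 (m ≟ i)           ≡⟨ cong (𝟙 (m ≟ j) +_) (sym (rowδ i≤c m)) ⟩
    𝟙 (m ≟ j) + rowF (δ i c) m      ∎)
    where open ≡-Reasoning

  exchange-col : ∀ m → colPart A m ≡ 𝟙 (m ≟ j) + colPart B m
  exchange-col m = exchange-shift (colF-additive m) (𝟙 (m ≟ j))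
    (cong₂ _+_ (colδ i<j m) (sym (column-balance m)))

  exchange-rank : offDiagSum A ≡ suc (offDiagSum B)
  exchange-rank = exchange-shift rankF-additive 1 rank-balance

  exchange-lower : ∀ p q → toℕ q < toℕ p → ent A p q ≡ ent B p q
  exchange-lower p q q<p = begin
    ent A p q                             ≡⟨ sym (+-identityʳ _) ⟩
    ent A p q + 0                         ≡⟨ cong (ent A p q +_) (sym (δ-lower i≤c q<p)) ⟩
    ent A p q + δ i c p q                 ≡⟨ identity p q ⟩
    ent B p q + δ i j p q + δ j k p q     ≡⟨ cong₂ (λ y z → ent B p q + y + z)
                                                   (δ-lower (<⇒≤ i<j) q<p) (δ-lower j≤k q<p) ⟩
    ent B p q + 0 + 0                     ≡⟨ trans (+-identityʳ _) (+-identityʳ _) ⟩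
    ent B p q                             ∎
    where open ≡-Reasoning

  exchange-hook : ∀ m → hook B m ≡ hook A m
  exchange-hook m =
    sym (trans (cong₂ (λ r c → ⁺ r ℤ.- ⁺ c) (exchange-row m) (exchange-col m))
               (hook-shift (𝟙 (m ≟ j)) (rowPart B m) (colPart B m)))

  exchange-InT⁻ : ∀ {α} → InT α A → InT α B
  exchange-InT⁻ (upper , hooks) =
    (λ p q q<p → trans (sym (exchange-lower p q q<p)) (upper p q q<p)) ,
    (λ m → trans (exchange-hook m) (hooks m))

  exchange-InT⁺ : ∀ {α} → InT α B → InT α A
  exchange-InT⁺ (upper , hooks) =
    (λ p q q<p → trans (exchange-lower p q q<p) (upper p q q<p)) ,
    (λ m → trans (sym (exchange-hook m)) (hooks m))

-- Three pairwise distinct cells: a lost cell (a,b) and gained cells (c,d), (e,f).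
-- A move through these cells satisfies the exchange identity, and a matrix
-- positive at both gained cells is the end of a move from 'undo A'.

flip-cell : ∀ {n} {a b c d : Fin n} → ¬ (a ≡ c × b ≡ d) → ¬ (c ≡ a × d ≡ b)
flip-cell ne (refl , refl) = ne (refl , refl)

module ThreeCells {n} {a b c d e f : Fin n}
  (c≠a : ¬ (c ≡ a × d ≡ b)) (e≠a : ¬ (e ≡ a × f ≡ b)) (e≠c : ¬ (e ≡ c × f ≡ d)) where

  private
    at-gained₁ : ∀ {x y u v w} → x ≡ suc y → u ≡ 0 → v ≡ 1 → w ≡ 0 → x + u ≡ y + v + w
    at-gained₁ {y = y} refl refl refl refl = cong (_+ 0) (+-comm 1 y)

    at-gained₂ : ∀ {x y u v w} → x ≡ suc y → u ≡ 0 → v ≡ 0 → w ≡ 1 → x + u ≡ y + v + w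
    at-gained₂ {y = y} refl refl refl refl = sym (+-comm (y + 0) 1)

    at-lost : ∀ {x y u v w} → suc x ≡ y → u ≡ 1 → v ≡ 0 → w ≡ 0 → x + u ≡ y + v + w
    at-lost {x = x} refl refl refl refl =
      trans (+-comm x 1) (sym (trans (+-identityʳ (suc x + 0)) (+-identityʳ (suc x))))

    elsewhere : ∀ {x y u v w} → x ≡ y → u ≡ 0 → v ≡ 0 → w ≡ 0 → x + u ≡ y + v + w
    elsewhere {x = x} refl refl refl refl = sym (+-identityʳ (x + 0))

  exchange-identity : ∀ {B A : Mat n} →
    ent A c d ≡ suc (ent B c d) → ent A e f ≡ suc (ent B e f) → suc (ent A a b) ≡ ent B a b →
    (∀ p q → ¬ (p ≡ c × q ≡ d) → ¬ (p ≡ e × q ≡ f) → ¬ (p ≡ a × q ≡ b) → ent A p q ≡ ent B p q) →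
    ∀ p q → ent A p q + δ a b p q ≡ ent B p q + δ c d p q + δ e f p q
  exchange-identity gain₁ gain₂ lost rest p q with (p ≟ c) ×-dec (q ≟ d)
  ... | yes (refl , refl) = at-gained₁ gain₁ (δ-miss c≠a) δ-hit (δ-miss (flip-cell e≠c))
  ... | no ≠cd with (p ≟ e) ×-dec (q ≟ f)
  ...   | yes (refl , refl) = at-gained₂ gain₂ (δ-miss e≠a) (δ-miss e≠c) δ-hit
  ...   | no ≠ef with (p ≟ a) ×-dec (q ≟ b)
  ...     | yes (refl , refl) = at-lost lost δ-hit (δ-miss (flip-cell c≠a)) (δ-miss (flip-cell e≠a))
  ...     | no ≠ab = elsewhere (rest p q ≠cd ≠ef ≠ab) (δ-miss ≠ab) (δ-miss ≠cd) (δ-miss ≠ef)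

  undo : Mat n → Mat n
  undo A = toMat λ p q → ent A p q + δ a b p q ∸ δ c d p q ∸ δ e f p q

  ent-undo : ∀ A p q → ent (undo A) p q ≡ ent A p q + δ a b p q ∸ δ c d p q ∸ δ e f p q
  ent-undo A = ent-toMat _

  private
    take₁ : ∀ {x u v w} → 0 < x → u ≡ 0 → v ≡ 1 → w ≡ 0 → x ≡ suc (x + u ∸ v ∸ w)
    take₁ {suc x} _ refl refl refl = cong suc (sym (+-identityʳ x))

    take₂ : ∀ {x u v w} → 0 < x → u ≡ 0 → v ≡ 0 → w ≡ 1 → x ≡ suc (x + u ∸ v ∸ w)
    take₂ {suc x} _ refl refl refl = cong suc (sym (+-identityʳ x))

    give : ∀ {x u v w} → u ≡ 1 → v ≡ 0 → w ≡ 0 → suc x ≡ x + u ∸ v ∸ w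
    give {x} refl refl refl = sym (+-comm x 1)

    keep : ∀ {x u v w} → u ≡ 0 → v ≡ 0 → w ≡ 0 → x ≡ x + u ∸ v ∸ w
    keep {x} refl refl refl = sym (+-identityʳ x)

  module _ (A : Mat n) where
    undo-gained₁ : 0 < ent A c d → ent A c d ≡ suc (ent (undo A) c d)
    undo-gained₁ pos = trans (take₁ pos (δ-miss c≠a) δ-hit (δ-miss (flip-cell e≠c)))
                             (cong suc (sym (ent-undo A c d)))

    undo-gained₂ : 0 < ent A e f → ent A e f ≡ suc (ent (undo A) e f)
    undo-gained₂ pos = trans (take₂ pos (δ-miss e≠a) (δ-miss e≠c) δ-hit)
                             (cong suc (sym (ent-undo A e f)))

    undo-lost : suc (ent A a b) ≡ ent (undo A) a b
    undo-lost = trans (give δ-hit (δ-miss (flip-cell c≠a)) (δ-miss (flip-cell e≠a)))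
                      (sym (ent-undo A a b))

    undo-elsewhere : ∀ p q → ¬ (p ≡ c × q ≡ d) → ¬ (p ≡ e × q ≡ f) → ¬ (p ≡ a × q ≡ b) →
      ent A p q ≡ ent (undo A) p q
    undo-elsewhere p q ≠cd ≠ef ≠ab =
      trans (keep (δ-miss ≠ab) (δ-miss ≠cd) (δ-miss ≠ef)) (sym (ent-undo A p q))

-- The first move exchanges (i,k) for (i,j), (j,k); the second (i,i) for (i,j), (j,j).

module Move₁Cells {n} {i j k : Fin n} (i<j : toℕ i < toℕ j) (j<k : toℕ j < toℕ k) =
  ThreeCells {a = i} {k} {i} {j} {j} {k}
    (<⇒≢ᶠ j<k ∘ proj₂) (<⇒≢ᶠ i<j ∘ sym ∘ proj₁) (<⇒≢ᶠ i<j ∘ sym ∘ proj₁)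

module Move₂Cells {n} {i j : Fin n} (i<j : toℕ i < toℕ j) =
  ThreeCells {a = i} {i} {i} {j} {j} {j}
    (<⇒≢ᶠ i<j ∘ sym ∘ proj₂) (<⇒≢ᶠ i<j ∘ sym ∘ proj₁) (<⇒≢ᶠ i<j ∘ sym ∘ proj₁)

step-exchange : ∀ {n} (B A : Mat n) → Step B A → Exchange B A
step-exchange B A (inj₁ (i , j , k , i<j , j<k , gain₁ , gain₂ , lost , rest)) = record
  { i = i ; j = j ; k = k ; c = k
  ; i<j = i<j ; j≤k = <⇒≤ j<k ; i≤c = <⇒≤ i<k
  ; column-balance = λ m → trans (colδ i<k m) (sym (colδ j<k m))
  ; rank-balance   = trans (cong₂ _+_ (rankδ i<j) (rankδ j<k)) (cong suc (sym (rankδ i<k)))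
  ; identity       = Move₁Cells.exchange-identity i<j j<k {B} {A} gain₁ gain₂ lost rest }
  where i<k = <-trans i<j j<k
step-exchange B A (inj₂ (i , j , i<j , gain₁ , gain₂ , lost , rest)) = record
  { i = i ; j = j ; k = j ; c = i
  ; i<j = i<j ; j≤k = ≤-refl ; i≤c = ≤-refl
  ; column-balance = λ m → trans (colδ-diag i m) (sym (colδ-diag j m))
  ; rank-balance   = trans (cong₂ _+_ (rankδ i<j) (rankδ-diag j)) (cong suc (sym (rankδ-diag i)))
  ; identity       = Move₂Cells.exchange-identity i<j {B} {A} gain₁ gain₂ lost rest }

step-rank : ∀ {n} (B A : Mat n) → Step B A → offDiagSum A ≡ suc (offDiagSum B)
step-rank B A s = exchange-rank (step-exchange B A s)

≼-rank : ∀ {n} {B A : Mat n} → B ≼ A → offDiagSum B ≤ offDiagSum A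
≼-rank ≼-refl       = ≤-refl
≼-rank (≼-step {B} {C} s r) =
  ≤-trans (≤-trans (n≤1+n _) (≤-reflexive (sym (step-rank B C s)))) (≼-rank r)

≼-rank-strict : ∀ {n} {B A : Mat n} → B ≼ A → B ≡ A ⊎ offDiagSum B < offDiagSum A
≼-rank-strict ≼-refl       = inj₁ refl
≼-rank-strict (≼-step {B} {C} s r) =
  inj₂ (≤-trans (≤-reflexive (sym (step-rank B C s))) (≼-rank r))

-- a move between elements of T(α) is a cover, since ρ rises by one only
step-covers : ∀ {n} {α : Fin n → ℕ} {B A : Mat n} → InT α B → InT α A → Step B A → Covers α B A
step-covers {B = B} {A} inB inA s = inB , inA , ≼-step s ≼-refl , B≢A , between
  where
  B≢A : B ≢ A
  B≢A B≡A = <-irrefl (cong offDiagSum B≡A) (≤-reflexive (sym (step-rank B A s)))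
  between : ∀ C → InT _ C → B ≼ C → C ≼ A → C ≡ B ⊎ C ≡ A
  between C _ B≼C C≼A with ≼-rank-strict B≼C | ≼-rank-strict C≼A
  ... | inj₁ B≡C | _         = inj₁ (sym B≡C)
  ... | inj₂ _   | inj₁ C≡A  = inj₂ C≡A
  ... | inj₂ B<C | inj₂ C<A  =
    ⊥-elim (<-irrefl refl (≤-trans (s≤s B<C) (≤-trans C<A (≤-reflexive (step-rank B A s)))))

-- every cover raises ρ by exactly one: its first move already lands at the top
covers-rank : ∀ {n} {α : Fin n → ℕ} {B A : Mat n} → Covers α B A → offDiagSum A ≡ suc (offDiagSum B)
covers-rank (_ , _ , ≼-refl , B≢A , _) = ⊥-elim (B≢A refl)
covers-rank {B = B} (inB , _ , ≼-step {C = C} s C≼A , _ , between)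
  with between C (exchange-InT⁺ (step-exchange B C s) inB) (≼-step s ≼-refl) C≼A
... | inj₁ C≡B = ⊥-elim (<-irrefl (cong offDiagSum (sym C≡B)) (≤-reflexive (sym (step-rank B C s))))
... | inj₂ C≡A = trans (cong offDiagSum (sym C≡A)) (step-rank B C s)

chain-rank : ∀ {n} {α : Fin n → ℕ} {B A : Mat n} (c : SatChain α B A) →
  chainLength c + offDiagSum B ≡ offDiagSum A
chain-rank done = refl
chain-rank {B = B} (cov ∷ c) =
  trans (sym (+-suc (chainLength c) (offDiagSum B)))
        (trans (cong (chainLength c +_) (sym (covers-rank cov))) (chain-rank c))

_∷ʳ_ : ∀ {n} {α : Fin n → ℕ} {X B A : Mat n} → SatChain α X B → Covers α B A → SatChain α X A
done      ∷ʳ cov = cov ∷ done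
(c ∷ cs)  ∷ʳ cov = c ∷ (cs ∷ʳ cov)

ent-zeroHat : ∀ {n} (α : Fin n → ℕ) p q → ent (zeroHat α) p q ≡ (if does (p ≟ q) then α p else 0)
ent-zeroHat α = ent-toMat (λ p q → if does (p ≟ q) then α p else 0)

rank-zeroHat : ∀ {n} (α : Fin n → ℕ) → offDiagSum (zeroHat α) ≡ 0
rank-zeroHat α = sum-zero _ (λ i → msum-vanish (rightOf i) (ent (zeroHat α) i) (λ j i<j →
  trans (ent-zeroHat α i j) (off-diagonal (i ≟ j) (<⇒≢ᶠ i<j))))
  where
  off-diagonal : ∀ {i j : Fin _} (d : Dec (i ≡ j)) → i ≢ j → (if does d then α i else 0) ≡ 0
  off-diagonal (yes i≡j) i≢j = ⊥-elim (i≢j i≡j)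
  off-diagonal (no _)    _   = refl

rank-zero : ∀ {n} {α : Fin n → ℕ} (A : Mat n) → InT α A → offDiagSum A ≡ 0 → A ≡ zeroHat α
rank-zero {n} {α} A (upper , hooks) ρ≡0 =
  mat-ext A (zeroHat α) (λ p q → trans (entry p q (p ≟ q)) (sym (ent-zeroHat α p q)))
  where
  -- every off-diagonal entry vanishes: above the diagonal since ρ(A) = 0
  off-diagonal : ∀ {p q} → p ≢ q → ent A p q ≡ 0
  off-diagonal {p} {q} p≢q with <-cmp (toℕ p) (toℕ q)
  ... | tri< p<q _ _ = n≤0⇒n≡0 (≤-trans (msum-term (rightOf p) (ent A p) q p<q)
                                        (≤-trans (term≤sum (λ i → msum (rightOf i) (ent A i)) p) (≤-reflexive ρ≡0)))
  ... | tri≈ _ p≡q _ = ⊥-elim (p≢q (toℕ-injective p≡q))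
  ... | tri> _ _ q<p = upper p q q<p
  -- so the hook at p reads a_pp - 0 = α p
  diagonal : ∀ p → ent A p p ≡ α p
  diagonal p = begin
    ent A p p                      ≡⟨ sym (msum-point (onOrRightOf p) (ent A p) p ≤-refl (λ q q≢p → off-diagonal (q≢p ∘ sym))) ⟩
    rowPart A p                    ≡⟨ hook-split _ _ (α p) (subst (λ c → ⁺ rowPart A p ℤ.- ⁺ c ≡ ⁺ α p) col≡0 (hooks p)) ⟩
    α p + 0                        ≡⟨ +-identityʳ (α p) ⟩
    α p                            ∎
    where
    open ≡-Reasoning
    col≡0 : colPart A p ≡ 0
    col≡0 = msum-vanish (above p) (λ i → ent A i p) (λ i i<p → off-diagonal (<⇒≢ᶠ i<p))
  entry : ∀ p q (d : Dec (p ≡ q)) → ent A p q ≡ (if does d then α p else 0)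
  entry p .p (yes refl) = diagonal p
  entry p q  (no p≢q)   = off-diagonal p≢q

positive-above : ∀ {n} (A : Mat n) → 0 < offDiagSum A →
  ∃ λ i → ∃ λ j → toℕ i < toℕ j × 0 < ent A i j
positive-above A ρ>0 with sum-pos (λ i → msum (rightOf i) (ent A i)) ρ>0
... | i , row>0 with msum-pos (rightOf i) (ent A i) row>0
...   | j , i<j , aij>0 = i , j , i<j , aij>0

-- in T(α), a positive entry a_ij (i < j) in column j forces a positive entry
-- a_jk (j ≤ k) in row j, since a_ij ≤ colPart A j ≤ rowPart A j by the hook at j
positive-in-row : ∀ {n} {α : Fin n → ℕ} (A : Mat n) → InT α A → ∀ {i j} →
  toℕ i < toℕ j → 0 < ent A i j → ∃ λ k → toℕ j ≤ toℕ k × 0 < ent A j k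
positive-in-row {α = α} A (_ , hooks) {i} {j} i<j aij>0 =
  msum-pos (onOrRightOf j) (ent A j) (≤-trans aij>0 aij≤row)
  where
  aij≤row : ent A i j ≤ rowPart A j
  aij≤row = ≤-trans (msum-term (above j) (λ x → ent A x j) i i<j)
    (≤-trans (m≤n+m _ (α j)) (≤-reflexive (sym (hook-split _ _ (α j) (hooks j)))))

-- undo the first move when j < k, the second when j = k
predecessor : ∀ {n} {α : Fin n → ℕ} (A : Mat n) → InT α A → 0 < offDiagSum A →
  Σ (Mat n) λ B → Step B A
predecessor A inA ρ>0 with positive-above A ρ>0
... | i , j , i<j , aij>0 with positive-in-row A inA i<j aij>0
...   | k , j≤k , ajk>0 with j ≟ k
...     | yes refl = M.undo A ,
          inj₂ (i , j , i<j , M.undo-gained₁ A aij>0 , M.undo-gained₂ A ajk>0 , M.undo-lost A ,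
                M.undo-elsewhere A)
  where module M = Move₂Cells i<j
...     | no j≢k = M.undo A ,
          inj₁ (i , j , k , i<j , j<k , M.undo-gained₁ A aij>0 , M.undo-gained₂ A ajk>0 , M.undo-lost A ,
                M.undo-elsewhere A)
  where j<k = ≤∧≢⇒< j≤k (j≢k ∘ toℕ-injective)
        module M = Move₁Cells i<j j<k

saturated-chain : ∀ {n} (α : Fin n → ℕ) d (A : Mat n) → InT α A → offDiagSum A ≡ d →
  SatChain α (zeroHat α) A
saturated-chain α zero A inA ρ≡0 = subst (SatChain α (zeroHat α)) (sym (rank-zero A inA ρ≡0)) done
saturated-chain α (suc d) A inA ρ≡d+1 with predecessor A inA (subst (0 <_) (sym ρ≡d+1) (s≤s z≤n))
... | B , s = saturated-chain α d B inB (suc-injective (trans (sym (step-rank B A s)) ρ≡d+1))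
              ∷ʳ step-covers inB inA s
  where inB = exchange-InT⁻ (step-exchange B A s) inA

mainTheorem4 : (n : ℕ) (α : Fin n → ℕ) (A : Mat n) → InT α A →
    SatChain α (zeroHat α) A ×
    ((c : SatChain α (zeroHat α) A) → chainLength c ≡ offDiagSum A)
mainTheorem4 n α A inA = saturated-chain α (offDiagSum A) A inA refl , length≡rank
  where
  length≡rank : (c : SatChain α (zeroHat α) A) → chainLength c ≡ offDiagSum A
  length≡rank c = begin
    chainLength c                           ≡⟨ sym (+-identityʳ _) ⟩
    chainLength c + 0                       ≡⟨ cong (chainLength c +_) (sym (rank-zeroHat α)) ⟩
    chainLength c + offDiagSum (zeroHat α)  ≡⟨ chain-rank c ⟩
    offDiagSum A                            ∎
    where open ≡-Reasoning
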